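{- The following two statements are equivalent: (a) For every bridgeless cubic graph $G$, we have $P \prec G$, where $P$ is the Petersen graph (i.e. every bridgeless cubic graph admits a $P$-coloring). (b) There exists a sublinear function $f:\mathbb{N}\rightarrow\mathbb{N}$ such that every bridgeless cubic graph $G$ admits a proper $5$-edge-coloring $c$ with $|N_G(c)|\leq f(|V(G)|)$.
   Context: Graphs are finite, undirected, loopless, and may have parallel edges; they need not be connected. For a vertex $v$ of $G$, $\partial_G(v)$ denotes the set of edges incident to $v$. For cubic graphs $G,H$, an $H$-coloring of $G$ is a map $\phi:E(G)\to E(H)$ such that for each $v\in V(G)$ there is $w\in V(H)$ with $\phi(\partial_G(v))=\partial_H(w)$; we write $H\prec G$ if $G$ has an $H$-coloring. A function $f:\mathbb{N}\to\mathbb{N}$ is sublinear if $\lim_{n\to+\infty} f(n)/n=0$. A proper $k$-edge-coloring assigns colors from $\{1,\dots,k\}$ to edges so that adjacent edges get different colors. For an edge-coloring $c$, $S_c(v)$ is the set of colors on edges incident to $v$. An edge $uv$ of a cubic graph is poor if $|S_c(u)\cup S_c(v)|=3$, rich if $|S_c(u)\cup S_c(v)|=5$, and abnormal otherwise. $N_G(c)$ is the set of abnormal edges of $G$ with respect to $c$. -}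

module Defs where

open import Data.Nat using (ℕ; zero; suc; _+_; _*_; _≤_)
open import Data.Bool using (Bool; true; false; _∨_; _∧_; not; if_then_else_)
open import Data.Fin using (Fin; #_) renaming (zero to fz; suc to fs)
open import Data.Fin.Properties using (_≟_)
open import Data.Nat using (_≡ᵇ_)
open import Data.Product using (Σ; _×_; _,_; proj₁; proj₂; ∃)
open import Data.Sum using (_⊎_)
open import Data.Vec using (Vec; []; _∷_; lookup)
open import Relation.Nullary using (¬_)
open import Relation.Nullary.Decidable using (⌊_⌋)
open import Relation.Binary.PropositionalEquality using (_≡_; _≢_)
open import Function.Bundles using (_⇔_)

record Graph : Set where
  field
    nV   : ℕ
    nE   : ℕ
    ends : Fin nE → Fin nV × Fin nV
open Graph public

Loopless : Graph → Set
Loopless G = ∀ e → proj₁ (ends G e) ≢ proj₂ (ends G e)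

Inc : (G : Graph) → Fin (nE G) → Fin (nV G) → Set
Inc G e v = proj₁ (ends G e) ≡ v ⊎ proj₂ (ends G e) ≡ v

incb : (G : Graph) → Fin (nE G) → Fin (nV G) → Bool
incb G e v = ⌊ proj₁ (ends G e) ≟ v ⌋ ∨ ⌊ proj₂ (ends G e) ≟ v ⌋

count : ∀ {n} → (Fin n → Bool) → ℕ
count {zero}  p = 0
count {suc n} p = (if p fz then 1 else 0) + count (λ i → p (fs i))

anyF : ∀ {n} → (Fin n → Bool) → Bool
anyF {zero}  p = false
anyF {suc n} p = p fz ∨ anyF (λ i → p (fs i))

Cubic : Graph → Set
Cubic G = ∀ v → count (λ e → incb G e v) ≡ 3

data ReachAvoid (G : Graph) (a : Fin (nE G)) (u : Fin (nV G)) : Fin (nV G) → Set where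
  here : ReachAvoid G a u u
  step : ∀ {v w} (e : Fin (nE G)) → ReachAvoid G a u v → e ≢ a →
         (ends G e ≡ (v , w) ⊎ ends G e ≡ (w , v)) → ReachAvoid G a u w

IsBridge : (G : Graph) → Fin (nE G) → Set
IsBridge G e = ¬ ReachAvoid G e (proj₁ (ends G e)) (proj₂ (ends G e))

Bridgeless : Graph → Set
Bridgeless G = ∀ e → ¬ IsBridge G e

HColoring : (H G : Graph) → (Fin (nE G) → Fin (nE H)) → Set
HColoring H G φ = ∀ v → Σ (Fin (nV H)) λ w →
  ∀ e' → (Σ (Fin (nE G)) λ e → Inc G e v × φ e ≡ e') ⇔ Inc H e' w

_≺_ : Graph → Graph → Set
H ≺ G = Σ (Fin (nE G) → Fin (nE H)) (HColoring H G)

-- Petersen graph: outer cycle 0..4, spokes i–(5+i), inner pentagram (5+i)–(5+(i+2 mod 5)).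
petersenEdges : Vec (Fin 10 × Fin 10) 15
petersenEdges =
  (# 0 , # 1) ∷ (# 1 , # 2) ∷ (# 2 , # 3) ∷ (# 3 , # 4) ∷ (# 4 , # 0) ∷
  (# 0 , # 5) ∷ (# 1 , # 6) ∷ (# 2 , # 7) ∷ (# 3 , # 8) ∷ (# 4 , # 9) ∷
  (# 5 , # 7) ∷ (# 6 , # 8) ∷ (# 7 , # 9) ∷ (# 8 , # 5) ∷ (# 9 , # 6) ∷ []

Petersen : Graph
Petersen = record { nV = 10 ; nE = 15 ; ends = lookup petersenEdges }

-- Sublinear: lim f(n)/n = 0, i.e. for every k, eventually (k+1)·f(n) ≤ n.
Sublinear : (ℕ → ℕ) → Set
Sublinear f = ∀ k → ∃ λ N → ∀ n → N ≤ n → suc k * f n ≤ n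

ProperColoring : (G : Graph) (k : ℕ) → (Fin (nE G) → Fin k) → Set
ProperColoring G k c = ∀ e e' → e ≢ e' →
  (Σ (Fin (nV G)) λ v → Inc G e v × Inc G e' v) → c e ≢ c e'

inS : (G : Graph) {k : ℕ} → (Fin (nE G) → Fin k) → Fin (nV G) → Fin k → Bool
inS G c v col = anyF (λ e → incb G e v ∧ ⌊ c e ≟ col ⌋)

unionSize : (G : Graph) {k : ℕ} → (Fin (nE G) → Fin k) → Fin (nE G) → ℕ
unionSize G c e =
  count (λ col → inS G c (proj₁ (ends G e)) col ∨ inS G c (proj₂ (ends G e)) col)

-- abnormal: neither poor (3) nor rich (5)
abnormal : (G : Graph) {k : ℕ} → (Fin (nE G) → Fin k) → Fin (nE G) → Bool
abnormal G c e = not (unionSize G c e ≡ᵇ 3) ∧ not (unionSize G c e ≡ᵇ 5)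

numAbnormal : (G : Graph) {k : ℕ} → (Fin (nE G) → Fin k) → ℕ
numAbnormal G c = count (abnormal G c)

-- Jaeger: a cubic graph is Petersen-colourable iff it has a proper 5-edge-colouring in which
-- every edge is poor or rich. Composing a Petersen-colouring with such a colouring of the
-- Petersen graph itself gives one; conversely each colour set {x, y, z} names a
-- unique vertex of the Petersen graph, and an edge coloured α is sent to the edge of colour α at
-- that vertex, which is well defined because the two ends of a poor or rich edge name vertices
-- joined by their common α-edge. Abnormal edges are counted additively on disjoint unions, so if
-- f is sublinear then, for K large, some colouring of K copies of G has fewer than K abnormal
-- edges, one copy has none, and G is Petersen-colourable.
module Submission where

open import Defs
open import Data.Bool using (Bool; true; false; _∨_; _∧_; not; T; T?; if_then_else_)
import Data.Bool.Properties as 𝔹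
open import Data.Empty using (⊥; ⊥-elim)
open import Data.Fin using (Fin; #_; _↑ˡ_; _↑ʳ_; splitAt) renaming (zero to fz; suc to fs)
open import Data.Fin.Properties using (_≟_; all?; any?; suc-injective; ↑ˡ-injective; ↑ʳ-injective; splitAt-↑ˡ; splitAt-↑ʳ)
open import Data.Nat using (ℕ; zero; suc; _+_; _*_; _≤_; _<_; _≡ᵇ_; z≤n; s≤s)
import Data.Nat.Properties as ℕ
open import Data.Product using (Σ; ∃; _×_; _,_; proj₁; proj₂; map; map₂)
open import Data.Sum using (_⊎_; inj₁; inj₂; [_,_]′)
import Data.Sum as Sum
open import Data.Unit using (tt)
open import Data.Vec using (Vec; []; _∷_; lookup)
open import Function.Base using (_∘_)
open import Function.Bundles using (_⇔_; mk⇔; Equivalence)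
open import Function.Definitions using (Injective)
import Function.Properties.Equivalence as ⇔
open import Relation.Nullary using (Dec; yes; no; ¬_; ¬?)
open import Relation.Nullary.Decidable
  using (⌊_⌋; from-yes; toWitness; fromWitness; toWitnessFalse; fromWitnessFalse; _⊎-dec_; _×-dec_; _→-dec_)
open import Relation.Binary.PropositionalEquality
  using (_≡_; _≢_; _≗_; refl; sym; trans; cong; cong₂; subst; subst₂; module ≡-Reasoning)

open Equivalence using (to; from)

-- Finite Boolean predicates

T-⇔→≡ : ∀ {a b} → T a ⇔ T b → a ≡ b
T-⇔→≡ a⇔b = 𝔹.⇔→≡ (⇔.trans (⇔.sym 𝔹.T-≡) (⇔.trans a⇔b 𝔹.T-≡))

⌊fs≟fs⌋ : ∀ {n} (x y : Fin n) → ⌊ fs x ≟ fs y ⌋ ≡ ⌊ x ≟ y ⌋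
⌊fs≟fs⌋ x y = T-⇔→≡ (mk⇔ (fromWitness ∘ suc-injective ∘ toWitness) (fromWitness ∘ cong fs ∘ toWitness))

count-cong : ∀ {n} {p q : Fin n → Bool} → p ≗ q → count p ≡ count q
count-cong {zero}  p≗q = refl
count-cong {suc n} p≗q =
  cong₂ _+_ (cong (λ b → if b then 1 else 0) (p≗q fz)) (count-cong (p≗q ∘ fs))

count-none : ∀ {n} (p : Fin n → Bool) → (∀ x → ¬ T (p x)) → count p ≡ 0
count-none {zero}  p none = refl
count-none {suc n} p none with p fz in eq
... | true  = ⊥-elim (none fz (subst T (sym eq) tt))
... | false = count-none (p ∘ fs) (none ∘ fs)

count≡0⇒none : ∀ {n} (p : Fin n → Bool) → count p ≡ 0 → ∀ x → ¬ T (p x)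
count≡0⇒none {suc n} p h x with p fz in eq
count≡0⇒none {suc n} p () x      | true
count≡0⇒none {suc n} p h fz     | false = subst T eq
count≡0⇒none {suc n} p h (fs x) | false = count≡0⇒none (p ∘ fs) h x

count-↑ : ∀ m {n} (p : Fin (m + n) → Bool) →
          count p ≡ count (λ i → p (i ↑ˡ n)) + count (λ j → p (m ↑ʳ j))
count-↑ zero        p = refl
count-↑ (suc m) {n} p =
  trans (cong ((if p fz then 1 else 0) +_) (count-↑ m (p ∘ fs)))
        (sym (ℕ.+-assoc (if p fz then 1 else 0) _ _))

anyF⁺ : ∀ {n} (p : Fin n → Bool) x → T (p x) → T (anyF p)
anyF⁺ p fz     px = from 𝔹.T-∨ (inj₁ px)
anyF⁺ p (fs x) px = from 𝔹.T-∨ (inj₂ (anyF⁺ (p ∘ fs) x px))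

anyF⁻ : ∀ {n} (p : Fin n → Bool) → T (anyF p) → ∃ λ x → T (p x)
anyF⁻ {suc n} p h with to 𝔹.T-∨ h
... | inj₁ p0   = fz , p0
... | inj₂ rest = let (x , px) = anyF⁻ (p ∘ fs) rest in fs x , px

_∖_ : ∀ {n} → (Fin n → Bool) → Fin n → Fin n → Bool
(p ∖ a) x = p x ∧ not ⌊ x ≟ a ⌋

∖-intro : ∀ {n} (p : Fin n → Bool) {a x} → T (p x) → x ≢ a → T ((p ∖ a) x)
∖-intro p px x≢a = from 𝔹.T-∧ (px , fromWitnessFalse x≢a)

∖-elim : ∀ {n} (p : Fin n → Bool) {a} x → T ((p ∖ a) x) → T (p x) × x ≢ a
∖-elim p x h = map₂ toWitnessFalse (to (𝔹.T-∧ {p x}) h)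

count-remove : ∀ {n} (p : Fin n → Bool) {k} → count p ≡ suc k →
               ∃ λ a → T (p a) × count (p ∖ a) ≡ k
count-remove {suc n} p h with p fz in eq
... | true  = fz , subst T (sym eq) tt
                 , trans (count-cong λ x → 𝔹.∧-identityʳ (p (fs x))) (ℕ.suc-injective h)
... | false = let (a , pa , rest) = count-remove (p ∘ fs) h in
              fs a , pa , trans (count-cong λ x → cong (λ b → p (fs x) ∧ not b) (⌊fs≟fs⌋ x a)) rest

OneOf : {A : Set} → A → A → A → A → Set
OneOf x y z t = t ≡ x ⊎ t ≡ y ⊎ t ≡ z

Distinct : {A : Set} → A → A → A → Set
Distinct x y z = x ≢ y × x ≢ z × y ≢ z

ExactlyAt : {A : Set} → (A → Bool) → A → A → A → Set
ExactlyAt S x y z = ∀ t → T (S t) ⇔ OneOf x y z t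

record Triple {n : ℕ} (p : Fin n → Bool) : Set where
  constructor triple
  field
    x y z    : Fin n
    distinct : Distinct x y z
    exactly  : ExactlyAt p x y z

ExactlyAt-intro : {A : Set} {S : A → Bool} {x y z : A} → T (S x) → T (S y) → T (S z) →
                  (∀ t → T (S t) → OneOf x y z t) → ExactlyAt S x y z
ExactlyAt-intro sx sy sz only t = mk⇔ (only t) λ where
  (inj₁ refl)        → sx
  (inj₂ (inj₁ refl)) → sy
  (inj₂ (inj₂ refl)) → sz

ExactlyAt-unique : {A : Set} {S S′ : A → Bool} {x y z : A} →
                   ExactlyAt S x y z → ExactlyAt S′ x y z → S ≗ S′
ExactlyAt-unique S≐ S′≐ t = T-⇔→≡ (⇔.trans (S≐ t) (⇔.sym (S′≐ t)))

count≡3⇒Triple : ∀ {n} (p : Fin n → Bool) → count p ≡ 3 → Triple p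
count≡3⇒Triple p h with count-remove p h
... | a , pa , h₁ with count-remove (p ∖ a) h₁
... | b , pb , h₂ with count-remove ((p ∖ a) ∖ b) h₂
... | c , pc , h₃ with ∖-elim p b pb | ∖-elim (p ∖ a) c pc
... | p-b , b≢a | pc∖a , c≢b with ∖-elim p c pc∖a
... | p-c , c≢a =
  triple a b c (b≢a ∘ sym , c≢a ∘ sym , c≢b ∘ sym) (ExactlyAt-intro pa p-b p-c only)
  where
  only : ∀ t → T (p t) → OneOf a b c t
  only t pt with t ≟ a | t ≟ b | t ≟ c
  ... | yes t≡a | _       | _       = inj₁ t≡a
  ... | no _    | yes t≡b | _       = inj₂ (inj₁ t≡b)
  ... | no _    | no _    | yes t≡c = inj₂ (inj₂ t≡c)
  ... | no t≢a  | no t≢b  | no t≢c  =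
    ⊥-elim (count≡0⇒none _ h₃ t (∖-intro ((p ∖ a) ∖ b) (∖-intro (p ∖ a) (∖-intro p pt t≢a) t≢b) t≢c))

OneOf-rotate : {A : Set} {x y z t : A} → OneOf x y z t → OneOf y z x t
OneOf-rotate (inj₁ t≡x)        = inj₂ (inj₂ t≡x)
OneOf-rotate (inj₂ (inj₁ t≡y)) = inj₁ t≡y
OneOf-rotate (inj₂ (inj₂ t≡z)) = inj₂ (inj₁ t≡z)

OneOf-map : {A B : Set} (f : A → B) {x y z t : A} → OneOf x y z t → OneOf (f x) (f y) (f z) (f t)
OneOf-map f = Sum.map (cong f) (Sum.map (cong f) (cong f))

no-three-in-two : {A : Set} {x z u v w : A} → Distinct u v w →
                  u ≡ x ⊎ u ≡ z → v ≡ x ⊎ v ≡ z → w ≡ x ⊎ w ≡ z → ⊥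
no-three-in-two (u≢v , _ , _) (inj₁ refl) (inj₁ refl) _           = u≢v refl
no-three-in-two (u≢v , _ , _) (inj₂ refl) (inj₂ refl) _           = u≢v refl
no-three-in-two (_ , u≢w , _) (inj₁ refl) (inj₂ _)    (inj₁ refl) = u≢w refl
no-three-in-two (_ , _ , v≢w) (inj₁ _)    (inj₂ refl) (inj₂ refl) = v≢w refl
no-three-in-two (_ , _ , v≢w) (inj₂ _)    (inj₁ refl) (inj₁ refl) = v≢w refl
no-three-in-two (_ , u≢w , _) (inj₂ refl) (inj₁ _)    (inj₂ refl) = u≢w refl

covered⇒first-two-distinct : {A : Set} {x y z u v w : A} → Distinct u v w →
                             OneOf x y z u → OneOf x y z v → OneOf x y z w → x ≢ y
covered⇒first-two-distinct {x = x} {z = z} d hu hv hw refl =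
  no-three-in-two d (merge hu) (merge hv) (merge hw)
  where
  merge : ∀ {t} → OneOf x x z t → t ≡ x ⊎ t ≡ z
  merge = [ inj₁ , (λ t∈ → t∈) ]′

covered⇒Distinct : {A : Set} {x y z u v w : A} → Distinct u v w →
                   OneOf x y z u → OneOf x y z v → OneOf x y z w → Distinct x y z
covered⇒Distinct {x = x} {y} {z} d hu hv hw =
  covered⇒first-two-distinct d hu hv hw ,
  (λ x≡z → covered⇒first-two-distinct d (rotate² hu) (rotate² hv) (rotate² hw) (sym x≡z)) ,
  covered⇒first-two-distinct d (OneOf-rotate hu) (OneOf-rotate hv) (OneOf-rotate hw)
  where
  rotate² : ∀ {t} → OneOf x y z t → OneOf z x y t
  rotate² = OneOf-rotate ∘ OneOf-rotate

Distinct-image : {A B : Set} (f : A → B) {x y z e e′ : A} → Distinct (f x) (f y) (f z) →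
                 OneOf x y z e → OneOf x y z e′ → e ≢ e′ → f e ≢ f e′
Distinct-image f _           (inj₁ refl)        (inj₁ refl)        e≢e′ = ⊥-elim (e≢e′ refl)
Distinct-image f (d , _ , _) (inj₁ refl)        (inj₂ (inj₁ refl)) _    = d
Distinct-image f (_ , d , _) (inj₁ refl)        (inj₂ (inj₂ refl)) _    = d
Distinct-image f (d , _ , _) (inj₂ (inj₁ refl)) (inj₁ refl)        _    = d ∘ sym
Distinct-image f _           (inj₂ (inj₁ refl)) (inj₂ (inj₁ refl)) e≢e′ = ⊥-elim (e≢e′ refl)
Distinct-image f (_ , _ , d) (inj₂ (inj₁ refl)) (inj₂ (inj₂ refl)) _    = d
Distinct-image f (_ , d , _) (inj₂ (inj₂ refl)) (inj₁ refl)        _    = d ∘ sym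
Distinct-image f (_ , _ , d) (inj₂ (inj₂ refl)) (inj₂ (inj₁ refl)) _    = d ∘ sym
Distinct-image f _           (inj₂ (inj₂ refl)) (inj₂ (inj₂ refl)) e≢e′ = ⊥-elim (e≢e′ refl)

triple-surjection-injective :
  ∀ {m n} {p : Fin m → Bool} {q : Fin n → Bool} (f : Fin m → Fin n) → Triple p → Triple q →
  (∀ y → T (q y) → ∃ λ x → T (p x) × f x ≡ y) →
  ∀ {x x′} → T (p x) → T (p x′) → x ≢ x′ → f x ≢ f x′
triple-surjection-injective f (triple a b c _ p≐) (triple a′ b′ c′ d′ q≐) onto px px′ =
  Distinct-image f
    (covered⇒Distinct d′ (cover (inj₁ refl)) (cover (inj₂ (inj₁ refl))) (cover (inj₂ (inj₂ refl))))
    (to (p≐ _) px) (to (p≐ _) px′)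
  where
  cover : ∀ {y} → OneOf a′ b′ c′ y → OneOf (f a) (f b) (f c) y
  cover {y} y∈ with onto y (from (q≐ y) y∈)
  ... | x , px , refl = OneOf-map f (to (p≐ x) px)

Inc? : (G : Graph) (e : Fin (nE G)) (v : Fin (nV G)) → Dec (Inc G e v)
Inc? G e v = proj₁ (ends G e) ≟ v ⊎-dec proj₂ (ends G e) ≟ v

incb⁺ : (G : Graph) {e : Fin (nE G)} {v : Fin (nV G)} → Inc G e v → T (incb G e v)
incb⁺ G {e} {v} = from (𝔹.T-∨ {⌊ proj₁ (ends G e) ≟ v ⌋} {⌊ proj₂ (ends G e) ≟ v ⌋})
                 ∘ Sum.map fromWitness fromWitness

incb⁻ : (G : Graph) {e : Fin (nE G)} {v : Fin (nV G)} → T (incb G e v) → Inc G e v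
incb⁻ G {e} {v} = Sum.map toWitness toWitness
                 ∘ to (𝔹.T-∨ {⌊ proj₁ (ends G e) ≟ v ⌋} {⌊ proj₂ (ends G e) ≟ v ⌋})

inS⁺ : (G : Graph) {k : ℕ} (c : Fin (nE G) → Fin k) (e : Fin (nE G)) {v : Fin (nV G)} →
       Inc G e v → T (inS G c v (c e))
inS⁺ G c e e∋v = anyF⁺ _ e (from 𝔹.T-∧ (incb⁺ G e∋v , fromWitness refl))

inS⁻ : (G : Graph) {k : ℕ} (c : Fin (nE G) → Fin k) {v : Fin (nV G)} {α : Fin k} →
       T (inS G c v α) → ∃ λ e → Inc G e v × c e ≡ α
inS⁻ G c h with anyF⁻ _ h
... | e , h′ with to 𝔹.T-∧ h′
... | e∋v , cα = e , incb⁻ G e∋v , toWitness cα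

abnormalPair : ∀ {k} → (Fin k → Bool) → (Fin k → Bool) → Bool
abnormalPair S S′ = not (count (λ α → S α ∨ S′ α) ≡ᵇ 3) ∧ not (count (λ α → S α ∨ S′ α) ≡ᵇ 5)

abnormalPair-cong : ∀ {k} {S₁ S₂ S₁′ S₂′ : Fin k → Bool} → S₁ ≗ S₂ → S₁′ ≗ S₂′ →
                    abnormalPair S₁ S₁′ ≡ abnormalPair S₂ S₂′
abnormalPair-cong S₁≗S₂ S₁′≗S₂′ =
  cong (λ n → not (n ≡ᵇ 3) ∧ not (n ≡ᵇ 5)) (count-cong λ α → cong₂ _∨_ (S₁≗S₂ α) (S₁′≗S₂′ α))

properColouring⇒colourTriple : ∀ {G k} {c : Fin (nE G) → Fin k} → Cubic G → ProperColoring G k c →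
                               ∀ v → Triple (inS G c v)
properColouring⇒colourTriple {G} {c = c} cubic proper v with count≡3⇒Triple _ (cubic v)
... | triple a b d (a≢b , a≢d , b≢d) ∂v≐ =
  triple (c a) (c b) (c d) (differ a≢b a∋v b∋v , differ a≢d a∋v d∋v , differ b≢d b∋v d∋v)
    (ExactlyAt-intro (inS⁺ G c a a∋v) (inS⁺ G c b b∋v) (inS⁺ G c d d∋v) only)
  where
  incident : ∀ {e} → OneOf a b d e → Inc G e v
  incident = incb⁻ G ∘ from (∂v≐ _)
  a∋v : Inc G a v
  a∋v = incident (inj₁ refl)
  b∋v : Inc G b v
  b∋v = incident (inj₂ (inj₁ refl))
  d∋v : Inc G d v
  d∋v = incident (inj₂ (inj₂ refl))
  differ : ∀ {e e′} → e ≢ e′ → Inc G e v → Inc G e′ v → c e ≢ c e′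
  differ e≢e′ e∋v e′∋v = proper _ _ e≢e′ (v , e∋v , e′∋v)
  only : ∀ α → T (inS G c v α) → OneOf (c a) (c b) (c d) α
  only α h with inS⁻ G c h
  ... | e , e∋v , refl = OneOf-map c (to (∂v≐ e) (incb⁺ G e∋v))

-- The Petersen graph

-- A proper 5-edge-colouring of the Petersen graph in which every edge is poor or rich; its ten
-- vertices receive the ten 3-subsets of the colours.
colour : Fin 15 → Fin 5
colour = lookup (# 0 ∷ # 1 ∷ # 2 ∷ # 3 ∷ # 4 ∷ # 2 ∷ # 3 ∷ # 4 ∷ # 0 ∷ # 1 ∷ # 3 ∷ # 4 ∷ # 0 ∷ # 1 ∷ # 2 ∷ [])

colours : Fin 10 → Fin 5 → Bool
colours = inS Petersen colour

-- The edge of colour α at w; the entries for the two colours missing at w are junk.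
edgeOfColour : Fin 10 → Fin 5 → Fin 15
edgeOfColour w α = lookup (lookup table w) α
  where
  table : Vec (Vec (Fin 15) 5) 10
  table = (# 0 ∷ # 0 ∷ # 5 ∷ # 0 ∷ # 4 ∷ []) ∷ (# 0 ∷ # 1 ∷ # 0 ∷ # 6 ∷ # 0 ∷ []) ∷
          (# 0 ∷ # 1 ∷ # 2 ∷ # 0 ∷ # 7 ∷ []) ∷ (# 8 ∷ # 0 ∷ # 2 ∷ # 3 ∷ # 0 ∷ []) ∷
          (# 0 ∷ # 9 ∷ # 0 ∷ # 3 ∷ # 4 ∷ []) ∷ (# 0 ∷ # 13 ∷ # 5 ∷ # 10 ∷ # 0 ∷ []) ∷
          (# 0 ∷ # 0 ∷ # 14 ∷ # 6 ∷ # 11 ∷ []) ∷ (# 12 ∷ # 0 ∷ # 0 ∷ # 10 ∷ # 7 ∷ []) ∷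
          (# 8 ∷ # 13 ∷ # 0 ∷ # 0 ∷ # 11 ∷ []) ∷ (# 12 ∷ # 9 ∷ # 14 ∷ # 0 ∷ # 0 ∷ []) ∷ []

-- Each fact is decided by evaluation; opacity keeps later type checking from unfolding the
-- decision procedures.
opaque
  Petersen-cubic : Cubic Petersen
  Petersen-cubic = from-yes (all? λ w → count (λ e → incb Petersen e w) ℕ.≟ 3)

  colour-proper : ∀ w e e′ → Inc Petersen e w → Inc Petersen e′ w → e ≢ e′ → colour e ≢ colour e′
  colour-proper = from-yes (all? λ w → all? λ e → all? λ e′ →
    Inc? Petersen e w →-dec Inc? Petersen e′ w →-dec ¬? (e ≟ e′) →-dec ¬? (colour e ≟ colour e′))

  colour-normal : ∀ e w w′ → Inc Petersen e w → Inc Petersen e w′ →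
                  ¬ T (abnormalPair (colours w) (colours w′))
  colour-normal = from-yes (all? λ e → all? λ w → all? λ w′ →
    Inc? Petersen e w →-dec Inc? Petersen e w′ →-dec ¬? (T? (abnormalPair (colours w) (colours w′))))

  vertexWithColours : ∀ x y z → Distinct x y z →
                      ∃ λ w → T (colours w x) × T (colours w y) × T (colours w z) ×
                              (∀ α → T (colours w α) → OneOf x y z α)
  vertexWithColours = from-yes (all? λ x → all? λ y → all? λ z →
    (¬? (x ≟ y) ×-dec ¬? (x ≟ z) ×-dec ¬? (y ≟ z)) →-dec
    any? λ w → T? (colours w x) ×-dec T? (colours w y) ×-dec T? (colours w z) ×-dec
               all? λ α → T? (colours w α) →-dec (α ≟ x ⊎-dec α ≟ y ⊎-dec α ≟ z))

  edgeOfColour-colour : ∀ w e → Inc Petersen e w → edgeOfColour w (colour e) ≡ e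
  edgeOfColour-colour = from-yes (all? λ w → all? λ e → Inc? Petersen e w →-dec edgeOfColour w (colour e) ≟ e)

  -- Two vertices whose colour sets are equal or share a single colour α are joined by an α-edge.
  edgeOfColour-shared : ∀ w w′ α → ¬ T (abnormalPair (colours w) (colours w′)) →
                        T (colours w α) → T (colours w′ α) → edgeOfColour w α ≡ edgeOfColour w′ α
  edgeOfColour-shared = from-yes (all? λ w → all? λ w′ → all? λ α →
    ¬? (T? (abnormalPair (colours w) (colours w′))) →-dec T? (colours w α) →-dec T? (colours w′ α) →-dec
    edgeOfColour w α ≟ edgeOfColour w′ α)

edgeOfColour-incident : ∀ {w α} → T (colours w α) → Inc Petersen (edgeOfColour w α) w
edgeOfColour-incident {w} {α} h with inS⁻ Petersen colour {w} {α} h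
... | e , e∋w , refl = subst (λ e′ → Inc Petersen e′ w) (sym (edgeOfColour-colour w e e∋w)) e∋w

-- Petersen-colourings and normal colourings

NormalColouring : Graph → Set
NormalColouring G =
  Σ (Fin (nE G) → Fin 5) λ c → ProperColoring G 5 c × (∀ e → ¬ T (abnormal G c e))

≺Petersen⇒NormalColouring : ∀ {G} → Cubic G → Petersen ≺ G → NormalColouring G
≺Petersen⇒NormalColouring {G} cubic (φ , hom) = colour ∘ φ , proper , normal
  where
  image : Fin (nV G) → Fin 10
  image v = proj₁ (hom v)

  incident-image : ∀ {e v} → Inc G e v → Inc Petersen (φ e) (image v)
  incident-image {e} {v} e∋v = to (proj₂ (hom v) (φ e)) (e , e∋v , refl)

  incident-preimage : ∀ {e′ v} → Inc Petersen e′ (image v) → ∃ λ e → Inc G e v × φ e ≡ e′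
  incident-preimage {e′} {v} = from (proj₂ (hom v) e′)

  colours-image : ∀ v → inS G (colour ∘ φ) v ≗ colours (image v)
  colours-image v α = T-⇔→≡ (mk⇔ forth back)
    where
    forth : T (inS G (colour ∘ φ) v α) → T (colours (image v) α)
    forth h with inS⁻ G (colour ∘ φ) h
    ... | e , e∋v , refl = inS⁺ Petersen colour (φ e) (incident-image e∋v)
    back : T (colours (image v) α) → T (inS G (colour ∘ φ) v α)
    back h with inS⁻ Petersen colour {image v} {α} h
    ... | e′ , e′∋w , refl with incident-preimage {e′} {v} e′∋w
    ... | e , e∋v , refl = inS⁺ G (colour ∘ φ) e e∋v

  φ-injective-at : ∀ {v e e′} → Inc G e v → Inc G e′ v → e ≢ e′ → φ e ≢ φ e′
  φ-injective-at {v} e∋v e′∋v = triple-surjection-injective φ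
    (count≡3⇒Triple (λ e → incb G e v) (cubic v))
    (count≡3⇒Triple (λ e′ → incb Petersen e′ (image v)) (Petersen-cubic (image v)))
    (λ e′ h → let (e , e∋v , φe≡e′) = incident-preimage (incb⁻ Petersen {e′} {image v} h)
              in e , incb⁺ G e∋v , φe≡e′)
    (incb⁺ G e∋v) (incb⁺ G e′∋v)

  proper : ProperColoring G 5 (colour ∘ φ)
  proper e e′ e≢e′ (v , e∋v , e′∋v) =
    colour-proper (image v) (φ e) (φ e′) (incident-image e∋v) (incident-image e′∋v) (φ-injective-at e∋v e′∋v e≢e′)

  normal : ∀ e → ¬ T (abnormal G (colour ∘ φ) e)
  normal e = subst (¬_ ∘ T) (abnormalPair-cong (sym ∘ colours-image u) (sym ∘ colours-image v))
    (colour-normal (φ e) (image u) (image v) (incident-image (inj₁ refl)) (incident-image (inj₂ refl)))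
    where
    u : Fin (nV G)
    u = proj₁ (ends G e)
    v : Fin (nV G)
    v = proj₂ (ends G e)

NormalColouring⇒≺Petersen : ∀ {G} → Cubic G → NormalColouring G → Petersen ≺ G
NormalColouring⇒≺Petersen {G} cubic (c , proper , normal) = φ , λ v → image v , λ e′ → mk⇔ (forth v e′) (back v e′)
  where
  open ≡-Reasoning

  colourTriple : ∀ v → Triple (inS G c v)
  colourTriple = properColouring⇒colourTriple cubic proper

  vertexOfColours : ∀ v → ∃ λ w → inS G c v ≗ colours w
  vertexOfColours v =
    let triple x y z distinct ≐xyz = colourTriple v
        (w , wx , wy , wz , only)  = vertexWithColours x y z distinct
    in w , ExactlyAt-unique ≐xyz (ExactlyAt-intro {S = colours w} wx wy wz only)

  image : Fin (nV G) → Fin 10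
  image v = proj₁ (vertexOfColours v)

  colours-image : ∀ v → inS G c v ≗ colours (image v)
  colours-image v = proj₂ (vertexOfColours v)

  present : ∀ {e v} → Inc G e v → T (colours (image v) (c e))
  present {e} {v} e∋v = subst T (colours-image v (c e)) (inS⁺ G c e e∋v)

  φ : Fin (nE G) → Fin 15
  φ e = edgeOfColour (image (proj₁ (ends G e))) (c e)

  φ-at : ∀ {e v} → Inc G e v → φ e ≡ edgeOfColour (image v) (c e)
  φ-at (inj₁ refl) = refl
  φ-at {e} (inj₂ refl) = edgeOfColour-shared (image u) (image v) (c e)
    (subst (¬_ ∘ T) (abnormalPair-cong (colours-image u) (colours-image v)) (normal e))
    (present (inj₁ refl)) (present (inj₂ refl))
    where
    u : Fin (nV G)
    u = proj₁ (ends G e)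
    v : Fin (nV G)
    v = proj₂ (ends G e)

  forth : ∀ v e′ → (∃ λ e → Inc G e v × φ e ≡ e′) → Inc Petersen e′ (image v)
  forth v _ (e , e∋v , refl) =
    subst (λ e′ → Inc Petersen e′ (image v)) (sym (φ-at e∋v)) (edgeOfColour-incident {image v} {c e} (present e∋v))

  back : ∀ v e′ → Inc Petersen e′ (image v) → ∃ λ e → Inc G e v × φ e ≡ e′
  back v e′ e′∋w =
    let (e , e∋v , ce≡colour) = inS⁻ G c {v} {colour e′}
          (subst T (sym (colours-image v (colour e′))) (inS⁺ Petersen colour e′ e′∋w))
    in e , e∋v , (begin
         φ e                                 ≡⟨ φ-at e∋v ⟩
         edgeOfColour (image v) (c e)        ≡⟨ cong (edgeOfColour (image v)) ce≡colour ⟩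
         edgeOfColour (image v) (colour e′)  ≡⟨ edgeOfColour-colour (image v) e′ e′∋w ⟩
         e′                                  ∎)

-- Disjoint unions

record Embedding (G U : Graph) : Set where
  field
    vertex           : Fin (nV G) → Fin (nV U)
    edge             : Fin (nE G) → Fin (nE U)
    vertex-injective : Injective _≡_ _≡_ vertex
    edge-injective   : Injective _≡_ _≡_ edge
    ends-edge        : ∀ e → ends U (edge e) ≡ map vertex vertex (ends G e)

-- The image is a union of components of U.
Closed : ∀ {G U} → Embedding G U → Set
Closed {G} {U} E = ∀ v {e′} → Inc U e′ (vertex v) → ∃ λ e → edge e ≡ e′
  where open Embedding E

module _ {G U : Graph} (E : Embedding G U) where
  open Embedding E

  private
    ends₁-edge : ∀ e → proj₁ (ends U (edge e)) ≡ vertex (proj₁ (ends G e))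
    ends₁-edge e = cong proj₁ (ends-edge e)

    ends₂-edge : ∀ e → proj₂ (ends U (edge e)) ≡ vertex (proj₂ (ends G e))
    ends₂-edge e = cong proj₂ (ends-edge e)

  Inc-embed : ∀ {e v} → Inc G e v → Inc U (edge e) (vertex v)
  Inc-embed {e} = Sum.map (trans (ends₁-edge e) ∘ cong vertex) (trans (ends₂-edge e) ∘ cong vertex)

  Inc-reflect : ∀ {e v} → Inc U (edge e) (vertex v) → Inc G e v
  Inc-reflect {e} = Sum.map (vertex-injective ∘ trans (sym (ends₁-edge e)))
                            (vertex-injective ∘ trans (sym (ends₂-edge e)))

  Inc-vertex : ∀ {e w} → Inc U (edge e) w → ∃ λ v → vertex v ≡ w
  Inc-vertex {e} (inj₁ e∋w) = proj₁ (ends G e) , trans (sym (ends₁-edge e)) e∋w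
  Inc-vertex {e} (inj₂ e∋w) = proj₂ (ends G e) , trans (sym (ends₂-edge e)) e∋w

  incb-embed : ∀ e v → incb U (edge e) (vertex v) ≡ incb G e v
  incb-embed e v = T-⇔→≡ (mk⇔ (incb⁺ G ∘ Inc-reflect ∘ incb⁻ U) (incb⁺ U ∘ Inc-embed ∘ incb⁻ G))

  nonLoop-embed : ∀ e → proj₁ (ends G e) ≢ proj₂ (ends G e) → proj₁ (ends U (edge e)) ≢ proj₂ (ends U (edge e))
  nonLoop-embed e ¬loop loop = ¬loop (vertex-injective (trans (sym (ends₁-edge e)) (trans loop (ends₂-edge e))))

  ReachAvoid-embed : ∀ {a u v} → ReachAvoid G a u v → ReachAvoid U (edge a) (vertex u) (vertex v)
  ReachAvoid-embed here = here
  ReachAvoid-embed (step e r e≢a e-joins) =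
    step (edge e) (ReachAvoid-embed r) (e≢a ∘ edge-injective) (Sum.map along along e-joins)
    where
    along : ∀ {p} → ends G e ≡ p → ends U (edge e) ≡ map vertex vertex p
    along ends≡p = trans (ends-edge e) (cong (map vertex vertex) ends≡p)

  nonBridge-embed : ∀ e → ¬ IsBridge G e → ¬ IsBridge U (edge e)
  nonBridge-embed e ¬bridge bridge = ¬bridge λ reach →
    bridge (subst₂ (ReachAvoid U (edge e)) (sym (ends₁-edge e)) (sym (ends₂-edge e)) (ReachAvoid-embed reach))

  ProperColoring-restrict : ∀ {k c} → ProperColoring U k c → ProperColoring G k (c ∘ edge)
  ProperColoring-restrict proper e e′ e≢e′ (v , e∋v , e′∋v) =
    proper (edge e) (edge e′) (e≢e′ ∘ edge-injective) (vertex v , Inc-embed e∋v , Inc-embed e′∋v)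

  module _ (closed : Closed E) where

    inS-embed : ∀ {k} (c : Fin (nE U) → Fin k) v → inS U c (vertex v) ≗ inS G (c ∘ edge) v
    inS-embed c v α = T-⇔→≡ (mk⇔ forth back)
      where
      forth : T (inS U c (vertex v) α) → T (inS G (c ∘ edge) v α)
      forth h with inS⁻ U c {vertex v} {α} h
      ... | e′ , e′∋v , refl with closed v e′∋v
      ... | e , refl = inS⁺ G (c ∘ edge) e (Inc-reflect e′∋v)
      back : T (inS G (c ∘ edge) v α) → T (inS U c (vertex v) α)
      back h with inS⁻ G (c ∘ edge) {v} {α} h
      ... | e , e∋v , refl = inS⁺ U c (edge e) (Inc-embed e∋v)

    abnormal-embed : ∀ {k} (c : Fin (nE U) → Fin k) e → abnormal U c (edge e) ≡ abnormal G (c ∘ edge) e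
    abnormal-embed c e =
      trans (cong (λ p → abnormalPair (inS U c (proj₁ p)) (inS U c (proj₂ p))) (ends-edge e))
            (abnormalPair-cong (inS-embed c _) (inS-embed c _))

⊕-ends : (G H : Graph) → Fin (nE G) ⊎ Fin (nE H) → Fin (nV G + nV H) × Fin (nV G + nV H)
⊕-ends G H = [ map (_↑ˡ nV H) (_↑ˡ nV H) ∘ ends G , map (nV G ↑ʳ_) (nV G ↑ʳ_) ∘ ends H ]′

_⊕_ : Graph → Graph → Graph
G ⊕ H = record { nV = nV G + nV H ; nE = nE G + nE H ; ends = ⊕-ends G H ∘ splitAt (nE G) }

data Split (m n : ℕ) : Fin (m + n) → Set where
  left  : (i : Fin m) → Split m n (i ↑ˡ n)
  right : (j : Fin n) → Split m n (m ↑ʳ j)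

split : ∀ m n (i : Fin (m + n)) → Split m n i
split zero    n i      = right i
split (suc m) n fz     = left fz
split (suc m) n (fs i) with split m n i
... | left i  = left (fs i)
... | right j = right j

↑ˡ≢↑ʳ : ∀ {m n} (i : Fin m) (j : Fin n) → i ↑ˡ n ≢ m ↑ʳ j
↑ˡ≢↑ʳ {m} {n} i j eq with trans (sym (splitAt-↑ˡ m i n)) (trans (cong (splitAt m) eq) (splitAt-↑ʳ m n j))
... | ()

module _ {G H : Graph} where
  open ≡-Reasoning

  inl : Embedding G (G ⊕ H)
  inl = record
    { vertex           = _↑ˡ nV H
    ; edge             = _↑ˡ nE H
    ; vertex-injective = ↑ˡ-injective (nV H) _ _
    ; edge-injective   = ↑ˡ-injective (nE H) _ _
    ; ends-edge        = λ e → cong (⊕-ends G H) (splitAt-↑ˡ (nE G) e (nE H))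
    }

  inr : Embedding H (G ⊕ H)
  inr = record
    { vertex           = nV G ↑ʳ_
    ; edge             = nE G ↑ʳ_
    ; vertex-injective = ↑ʳ-injective (nV G) _ _
    ; edge-injective   = ↑ʳ-injective (nE G) _ _
    ; ends-edge        = λ e → cong (⊕-ends G H) (splitAt-↑ʳ (nE G) (nE H) e)
    }

  inr-avoids-inl : ∀ j v → ¬ Inc (G ⊕ H) (nE G ↑ʳ j) (v ↑ˡ nV H)
  inr-avoids-inl j v j∋v = let (w , w≡v) = Inc-vertex inr j∋v in ↑ˡ≢↑ʳ v w (sym w≡v)

  inl-avoids-inr : ∀ i w → ¬ Inc (G ⊕ H) (i ↑ˡ nE H) (nV G ↑ʳ w)
  inl-avoids-inr i w i∋w = let (v , v≡w) = Inc-vertex inl i∋w in ↑ˡ≢↑ʳ v w v≡w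

  inl-closed : Closed inl
  inl-closed v {e′} e′∋v with split (nE G) (nE H) e′
  ... | left i  = i , refl
  ... | right j = ⊥-elim (inr-avoids-inl j v e′∋v)

  inr-closed : Closed inr
  inr-closed w {e′} e′∋w with split (nE G) (nE H) e′
  ... | left i  = ⊥-elim (inl-avoids-inr i w e′∋w)
  ... | right j = j , refl

  ⊕-loopless : Loopless G → Loopless H → Loopless (G ⊕ H)
  ⊕-loopless loopless-G loopless-H e with split (nE G) (nE H) e
  ... | left i  = nonLoop-embed inl i (loopless-G i)
  ... | right j = nonLoop-embed inr j (loopless-H j)

  ⊕-bridgeless : Bridgeless G → Bridgeless H → Bridgeless (G ⊕ H)
  ⊕-bridgeless bridgeless-G bridgeless-H e with split (nE G) (nE H) e
  ... | left i  = nonBridge-embed inl i (bridgeless-G i)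
  ... | right j = nonBridge-embed inr j (bridgeless-H j)

  ⊕-cubic : Cubic G → Cubic H → Cubic (G ⊕ H)
  ⊕-cubic cubic-G cubic-H x with split (nV G) (nV H) x
  ... | left v = begin
    count (λ e → incb (G ⊕ H) e (v ↑ˡ nV H))
      ≡⟨ count-↑ (nE G) _ ⟩
    count (λ i → incb (G ⊕ H) (i ↑ˡ nE H) (v ↑ˡ nV H)) + count (λ j → incb (G ⊕ H) (nE G ↑ʳ j) (v ↑ˡ nV H))
      ≡⟨ cong₂ _+_ (count-cong λ i → incb-embed inl i v) (count-none _ λ j → inr-avoids-inl j v ∘ incb⁻ (G ⊕ H)) ⟩
    count (λ i → incb G i v) + 0
      ≡⟨ ℕ.+-identityʳ _ ⟩
    count (λ i → incb G i v)
      ≡⟨ cubic-G v ⟩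
    3 ∎
  ... | right w = begin
    count (λ e → incb (G ⊕ H) e (nV G ↑ʳ w))
      ≡⟨ count-↑ (nE G) _ ⟩
    count (λ i → incb (G ⊕ H) (i ↑ˡ nE H) (nV G ↑ʳ w)) + count (λ j → incb (G ⊕ H) (nE G ↑ʳ j) (nV G ↑ʳ w))
      ≡⟨ cong₂ _+_ (count-none _ λ i → inl-avoids-inr i w ∘ incb⁻ (G ⊕ H)) (count-cong λ j → incb-embed inr j w) ⟩
    0 + count (λ j → incb H j w)
      ≡⟨ cubic-H w ⟩
    3 ∎

  numAbnormal-⊕ : ∀ {k} (c : Fin (nE (G ⊕ H)) → Fin k) →
                  numAbnormal (G ⊕ H) c ≡ numAbnormal G (c ∘ (_↑ˡ nE H)) + numAbnormal H (c ∘ (nE G ↑ʳ_))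
  numAbnormal-⊕ c = trans (count-↑ (nE G) (abnormal (G ⊕ H) c))
    (cong₂ _+_ (count-cong (abnormal-embed inl inl-closed c)) (count-cong (abnormal-embed inr inr-closed c)))

∅ : Graph
∅ = record { nV = 0 ; nE = 0 ; ends = λ () }

copies : ℕ → Graph → Graph
copies zero    G = ∅
copies (suc K) G = G ⊕ copies K G

module _ {G : Graph} where

  nV-copies : ∀ K → nV (copies K G) ≡ K * nV G
  nV-copies zero    = refl
  nV-copies (suc K) = cong (nV G +_) (nV-copies K)

  copies-loopless : ∀ K → Loopless G → Loopless (copies K G)
  copies-loopless zero    _        = λ ()
  copies-loopless (suc K) loopless = ⊕-loopless {G} {copies K G} loopless (copies-loopless K loopless)

  copies-cubic : ∀ K → Cubic G → Cubic (copies K G)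
  copies-cubic zero    _     = λ ()
  copies-cubic (suc K) cubic = ⊕-cubic {G} {copies K G} cubic (copies-cubic K cubic)

  copies-bridgeless : ∀ K → Bridgeless G → Bridgeless (copies K G)
  copies-bridgeless zero    _          = λ ()
  copies-bridgeless (suc K) bridgeless = ⊕-bridgeless {G} {copies K G} bridgeless (copies-bridgeless K bridgeless)

  copies-NormalColouring : ∀ K (c : Fin (nE (copies K G)) → Fin 5) → ProperColoring (copies K G) 5 c →
                           numAbnormal (copies K G) c < K → NormalColouring G
  copies-NormalColouring (suc K) c proper few with numAbnormal G (c ∘ (_↑ˡ nE (copies K G))) in first
  ... | zero  = c ∘ (_↑ˡ _) , ProperColoring-restrict (inl {G} {copies K G}) proper , count≡0⇒none _ first
  ... | suc a = copies-NormalColouring K (c ∘ (nE G ↑ʳ_)) (ProperColoring-restrict (inr {G} {copies K G}) proper)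
    (ℕ.≤-trans (s≤s (ℕ.m≤n+m _ a)) (ℕ.≤-pred (subst (_< suc K) split-count few)))
    where
    split-count : numAbnormal (copies (suc K) G) c ≡ suc a + numAbnormal (copies K G) (c ∘ (nE G ↑ʳ_))
    split-count = trans (numAbnormal-⊕ {G} {copies K G} c) (cong (_+ numAbnormal (copies K G) (c ∘ (nE G ↑ʳ_))) first)

const0-sublinear : Sublinear (λ _ → 0)
const0-sublinear k = 0 , λ n _ → subst (_≤ n) (sym (ℕ.*-zeroʳ (suc k))) z≤n

sublinear⇒f[K*n]<K : ∀ {f} → Sublinear f → ∀ n → ∃ λ K → f (K * n) < K
sublinear⇒f[K*n]<K {f} _ zero =
  suc (f 0) , subst (λ m → f m < suc (f 0)) (sym (ℕ.*-zeroʳ (suc (f 0)))) (ℕ.n<1+n (f 0))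
sublinear⇒f[K*n]<K {f} sublinear n@(suc _) = K , ℕ.*-cancelˡ-< (suc n) (f (K * n)) K (begin-strict
  suc n * f (K * n) ≤⟨ bound (K * n) (ℕ.≤-trans (ℕ.n≤1+n N) (ℕ.m≤m*n K n)) ⟩
  K * n             <⟨ ℕ.*-monoʳ-< K (ℕ.n<1+n n) ⟩
  K * suc n         ≡⟨ ℕ.*-comm K (suc n) ⟩
  suc n * K         ∎)
  where
  open ℕ.≤-Reasoning
  N : ℕ
  N = proj₁ (sublinear n)
  bound : ∀ m → N ≤ m → suc n * f m ≤ m
  bound = proj₂ (sublinear n)
  K : ℕ
  K = suc N

theorem1 : ((G : Graph) → Loopless G → Cubic G → Bridgeless G → Petersen ≺ G)
           ⇔ (Σ (ℕ → ℕ) λ f → Sublinear f ×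
                ((G : Graph) → Loopless G → Cubic G → Bridgeless G →
                   Σ (Fin (nE G) → Fin 5) λ c →
                     ProperColoring G 5 c × numAbnormal G c ≤ f (nV G)))
theorem1 = mk⇔
  (λ colourable → (λ _ → 0) , const0-sublinear , λ G loopless cubic bridgeless →
    let (c , proper , normal) = ≺Petersen⇒NormalColouring cubic (colourable G loopless cubic bridgeless)
    in c , proper , ℕ.≤-reflexive (count-none (abnormal G c) normal))
  (λ (f , sublinear , colouring) G loopless cubic bridgeless →
    let (K , small) = sublinear⇒f[K*n]<K sublinear (nV G)
        (c , proper , bound) = colouring (copies K G) (copies-loopless K loopless)
                                 (copies-cubic K cubic) (copies-bridgeless K bridgeless)
        few = ℕ.≤-<-trans (subst (λ n → numAbnormal (copies K G) c ≤ f n) (nV-copies K) bound) small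
    in NormalColouring⇒≺Petersen cubic (copies-NormalColouring K c proper few))
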